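{- Let $D$ be a loose multipartite tournament. If $C_{1,2}(D)$ has a hole of length at least five, then there exists a partite set $X$ of $D$ such that: (1) $X$ is the only partite set of $D$ that is not $\{1,2\}$-competing; (2) for every hole $L$ of $C_{1,2}(D)$ of length at least five, there exists a partite set $Y\ne X$ with $|Y|\ge|V(L)|$ and $V(L)\subseteq\{v\in V(D):\emptyset\ne N^+(v)\subseteq Y\}\subseteq X$.
   Context: All graphs and digraphs are finite and simple. For a digraph $D$ and vertex $v$, $N^+(v)$ is its out-neighborhood; $d_D(x,y)$ is the length of a shortest directed path from $x$ to $y$. The $(1,2)$-step competition graph $C_{1,2}(D)$ is the graph on $V(D)$ in which distinct $u,v$ are adjacent iff there is a vertex $w\notin\{u,v\}$ with either $d_{D-v}(u,w)\le 1$ and $d_{D-u}(v,w)\le 2$, or $d_{D-u}(v,w)\le 1$ and $d_{D-v}(u,w)\le 2$. A multipartite tournament is an orientation of a complete $k$-partite graph for some $k\ge3$ (with nonempty partite sets). A set of vertices is $\{1,2\}$-competing if it is a clique in $C_{1,2}(D)$. A multipartite tournament is loose if some partite set is not $\{1,2\}$-competing. A hole of a graph is an induced cycle of length at least four. -}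

module Defs where

open import Data.Nat using (ℕ; suc; _≤_; _≥_)
open import Data.Fin using (Fin; toℕ)
open import Data.Fin.Properties using (_≟_)
open import Data.Bool using (Bool; true; false)
open import Data.List using (length; filter; allFin)
open import Data.Product using (Σ; ∃; _×_; _,_)
open import Data.Sum using (_⊎_)
open import Relation.Binary.PropositionalEquality using (_≡_; _≢_)
open import Relation.Nullary using (¬_)
open import Function using (Injective)
open import Function.Bundles using (_⇔_)

-- Multipartite tournaments on the vertex set Fin n.
-- arc u v ≡ true means there is an arc u → v.
-- part v : Fin k is the index of the partite set containing v.

record MultipartiteTournament : Set where
  field
    n       : ℕ
    k       : ℕ
    arc     : Fin n → Fin n → Bool
    part    : Fin n → Fin k
    k≥3     : 3 ≤ k
    nonempty : ∀ (i : Fin k) → ∃ λ v → part v ≡ i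
    indep   : ∀ u v → part u ≡ part v → arc u v ≡ false
    orient  : ∀ u v → part u ≢ part v →
              (arc u v ≡ true × arc v u ≡ false) ⊎ (arc u v ≡ false × arc v u ≡ true)

module _ (D : MultipartiteTournament) where
  open MultipartiteTournament D

  Arc : Fin n → Fin n → Set
  Arc u v = arc u v ≡ true

  -- d_{D - a}(v , w) ≤ 2, for v , w ≠ a, v ≠ w:
  -- either a direct arc, or a path v → z → w with z ≠ a.
  Within2Avoiding : Fin n → Fin n → Fin n → Set
  Within2Avoiding a v w = Arc v w ⊎ (∃ λ z → z ≢ a × Arc v z × Arc z w)

  C12Adj : Fin n → Fin n → Set
  C12Adj u v = u ≢ v × (∃ λ w → w ≢ u × w ≢ v ×
      ((Arc u w × Within2Avoiding u v w) ⊎ (Arc v w × Within2Avoiding v u w)))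

  InPart : Fin k → Fin n → Set
  InPart i v = part v ≡ i

  partSize : Fin k → ℕ
  partSize i = length (filter (λ v → part v ≟ i) (allFin n))

  Competing : Fin k → Set
  Competing i = ∀ u v → InPart i u → InPart i v → u ≢ v → C12Adj u v

  Loose : Set
  Loose = ∃ λ i → ¬ Competing i

  OutInto : Fin k → Fin n → Set
  OutInto Y v = (∃ λ w → Arc v w) × (∀ w → Arc v w → InPart Y w)

  Succ : (m : ℕ) → Fin m → Fin m → Set
  Succ m j l = (toℕ l ≡ suc (toℕ j)) ⊎ (suc (toℕ j) ≡ m × toℕ l ≡ 0)

  Consec : (m : ℕ) → Fin m → Fin m → Set
  Consec m j l = Succ m j l ⊎ Succ m l j

  record Hole : Set where
    field
      len      : ℕ
      vtx      : Fin len → Fin n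
      len≥4    : len ≥ 4
      distinct : Injective _≡_ _≡_ vtx
      induced  : ∀ j l → j ≢ l → (C12Adj (vtx j) (vtx l) ⇔ Consec len j l)

{-# OPTIONS --safe #-}
module Submission where

-- Let p ⟶ q be an arc whose ends are non-adjacent in C₁,₂(D), with q not a sink. Any two
-- vertices other than p that dominate p or q are adjacent, and if p had a second out-neighbour then
-- every vertex other than p, q would dominate p or q; so as soon as two non-adjacent vertices avoid
-- p and q, N⁺(p) = {q}. Played out on five consecutive vertices of a 5-hole, or six of a longer
-- hole, this rules out any arc between hole vertices at distance 2 or 3, so a hole of length at
-- least 5 lies in a single partite set X. Non-adjacent vertices of one partite set send their arcs
-- into one partite set, hence all out-neighbours of the hole lie in one partite set Y ≠ X;
-- consecutive hole vertices then share an out-neighbour, and these are pairwise distinct, so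
-- |Y| ≥ |V(L)|. Finally, two vertices u, v of a partite set other than X are adjacent: otherwise
-- each of x₀, …, x₄ dominates u or v, and as non-adjacent hole vertices share no out-neighbour,
-- this two-colours the odd cycle x₀ x₂ x₄ x₁ x₃ of non-adjacent pairs.

open import Defs
open import Data.Nat using (ℕ; zero; suc; pred; _+_; _∸_; _≤_; _<_; _≥_; z≤n; s≤s; NonZero; >-nonZero; _%_)
open import Data.Nat.Properties
  using (_<?_; ≤-trans; <-trans; ≤-antisym; <-cmp; <⇒≤; <⇒≢; ≮⇒≥; m≤n⇒m<n∨m≡n; n≤1+n; m<n+m; +-monoˡ-<;
         ∸-monoˡ-<; m<n⇒0<n∸m; m∸n≤m; m∸n+n≡m; m+n∸m≡n; suc-pred; +-identityʳ; +-suc; +-comm)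
open import Data.Nat.DivMod using (m%n<n; m<n⇒m%n≡m; %-distribˡ-+; m≤n⇒[n∸m]%m≡n%m; [m+n]%n≡m%n; n%n≡0)
open import Data.Fin using (Fin; toℕ; fromℕ<)
import Data.Fin.Properties as Fin
open import Data.Bool using (true)
open import Data.Bool.Properties using (_≟_)
open import Data.Product using (∃; _×_; _,_; proj₁; proj₂)
open import Data.Sum using (_⊎_; inj₁; inj₂; swap)
open import Data.Empty using (⊥; ⊥-elim)
open import Data.List using (List; filter; allFin; lookup)
open import Data.List.Membership.Propositional using (_∈_)
open import Data.List.Membership.Propositional.Properties using (∈-filter⁺; ∈-allFin)
open import Data.List.Relation.Unary.Any using (index)
open import Data.List.Relation.Unary.Any.Properties using (lookup-index)
open import Relation.Binary.Definitions using (tri<; tri≈; tri>)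
open import Relation.Binary.PropositionalEquality
  using (_≡_; _≢_; refl; sym; trans; cong; subst; subst₂; ≢-sym; module ≡-Reasoning)
open import Relation.Nullary using (¬_; Dec; yes; no)
open import Function using (Injective)
open import Function.Bundles using (Equivalence)

module Arcs (D : MultipartiteTournament) where
  open MultipartiteTournament D

  infix 4 _⟶_ _∼_ _≁_

  _⟶_ : Fin n → Fin n → Set
  _⟶_ = Arc D

  _∼_ : Fin n → Fin n → Set
  _∼_ = C12Adj D

  _≁_ : Fin n → Fin n → Set
  u ≁ v = ¬ u ∼ v

  private variable a b p q t t′ u v w y z : Fin n

  arc⇒part≢ : u ⟶ v → part u ≢ part v
  arc⇒part≢ {u} {v} u⟶v eq with () ← trans (sym u⟶v) (indep u v eq)

  arc⇒≢ : u ⟶ v → u ≢ v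
  arc⇒≢ u⟶v refl = arc⇒part≢ u⟶v refl

  arc-asym : u ⟶ v → ¬ v ⟶ u
  arc-asym {u} {v} u⟶v v⟶u with orient u v (arc⇒part≢ u⟶v)
  ... | inj₁ (_ , v↛u) with () ← trans (sym v⟶u) v↛u
  ... | inj₂ (u↛v , _) with () ← trans (sym u⟶v) u↛v

  arc-connex : part u ≢ part v → u ⟶ v ⊎ v ⟶ u
  arc-connex {u} {v} u≢v with orient u v u≢v
  ... | inj₁ (u⟶v , _) = inj₁ u⟶v
  ... | inj₂ (_ , v⟶u) = inj₂ v⟶u

  ¬arc⇒arc : part u ≢ part v → ¬ u ⟶ v → v ⟶ u
  ¬arc⇒arc u≢v u↛v with arc-connex u≢v
  ... | inj₁ u⟶v = ⊥-elim (u↛v u⟶v)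
  ... | inj₂ v⟶u = v⟶u

  ¬arcs⇒part≡ : ¬ u ⟶ v → ¬ v ⟶ u → part u ≡ part v
  ¬arcs⇒part≡ {u} {v} u↛v v↛u with part u Fin.≟ part v
  ... | yes eq = eq
  ... | no neq with arc-connex neq
  ...   | inj₁ u⟶v = ⊥-elim (u↛v u⟶v)
  ...   | inj₂ v⟶u = ⊥-elim (v↛u v⟶u)

  arc? : ∀ u v → Dec (u ⟶ v)
  arc? u v = arc u v ≟ true

  ∼-sym : u ∼ v → v ∼ u
  ∼-sym (u≢v , w , w≢u , w≢v , inj₁ paths) = ≢-sym u≢v , w , w≢v , w≢u , inj₂ paths
  ∼-sym (u≢v , w , w≢u , w≢v , inj₂ paths) = ≢-sym u≢v , w , w≢v , w≢u , inj₁ paths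

  ≁-sym : u ≁ v → v ≁ u
  ≁-sym u≁v v∼u = u≁v (∼-sym v∼u)

  ∼⇒≢ : u ∼ v → u ≢ v
  ∼⇒≢ = proj₁

  ∼⇒out : u ∼ v → ∃ (u ⟶_)
  ∼⇒out (_ , w , _ , _ , inj₁ (u⟶w , _))                     = w , u⟶w
  ∼⇒out (_ , w , _ , _ , inj₂ (_ , inj₁ u⟶w))                = w , u⟶w
  ∼⇒out (_ , _ , _ , _ , inj₂ (_ , inj₂ (z , _ , u⟶z , _))) = z , u⟶z

  commonOut⇒∼ : u ≢ v → u ⟶ w → v ⟶ w → u ∼ v
  commonOut⇒∼ u≢v u⟶w v⟶w =
    u≢v , _ , ≢-sym (arc⇒≢ u⟶w) , ≢-sym (arc⇒≢ v⟶w) , inj₁ (u⟶w , inj₁ v⟶w)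

  ≁⇒¬commonOut : u ≁ v → u ≢ v → u ⟶ w → ¬ v ⟶ w
  ≁⇒¬commonOut u≁v u≢v u⟶w v⟶w = u≁v (commonOut⇒∼ u≢v u⟶w v⟶w)

  twoStep⇒∼ : u ≢ v → u ⟶ w → v ⟶ z → z ⟶ w → z ≢ u → w ≢ v → u ∼ v
  twoStep⇒∼ u≢v u⟶w v⟶z z⟶w z≢u w≢v =
    u≢v , _ , ≢-sym (arc⇒≢ u⟶w) , w≢v , inj₁ (u⟶w , inj₂ (_ , z≢u , v⟶z , z⟶w))

  ≁⇒outParts≡ : u ≁ v → u ≢ v → u ⟶ a → v ⟶ b → a ≢ v → b ≢ u → part a ≡ part b
  ≁⇒outParts≡ {a = a} {b = b} u≁v u≢v u⟶a v⟶b a≢v b≢u with part a Fin.≟ part b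
  ... | yes eq = eq
  ... | no neq with arc-connex neq
  ...   | inj₁ a⟶b = ⊥-elim (u≁v (∼-sym (twoStep⇒∼ (≢-sym u≢v) v⟶b u⟶a a⟶b a≢v b≢u)))
  ...   | inj₂ b⟶a = ⊥-elim (u≁v (twoStep⇒∼ u≢v u⟶a v⟶b b⟶a b≢u a≢v))

  part≡-≁⇒outParts≡ : part u ≡ part v → u ≁ v → u ≢ v → u ⟶ a → v ⟶ b → part a ≡ part b
  part≡-≁⇒outParts≡ uv u≁v u≢v u⟶a v⟶b =
    ≁⇒outParts≡ u≁v u≢v u⟶a v⟶b
      (λ { refl → arc⇒part≢ u⟶a uv }) (λ { refl → arc⇒part≢ v⟶b (sym uv) })

  injective⇒≤partSize : ∀ {m i} (f : Fin m → Fin n) → Injective _≡_ _≡_ f → (∀ j → part (f j) ≡ i) →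
                        m ≤ partSize D i
  injective⇒≤partSize {i = i} f f-injective f∈i =
    Fin.injective⇒≤ {f = λ j → index (f∈S j)} index-injective
    where
    S : List (Fin n)
    S = filter (λ v → part v Fin.≟ i) (allFin n)
    f∈S : ∀ j → f j ∈ S
    f∈S j = ∈-filter⁺ (λ v → part v Fin.≟ i) (∈-allFin (f j)) (f∈i j)
    index-injective : ∀ {j j′} → index (f∈S j) ≡ index (f∈S j′) → j ≡ j′
    index-injective eq = f-injective (trans (lookup-index (f∈S _))
                           (trans (cong (lookup S) eq) (sym (lookup-index (f∈S _)))))

  N⁺_⊆_ : Fin n → Fin k → Set
  N⁺ v ⊆ i = ∀ w → v ⟶ w → InPart D i w

  outParts⇒commonOut : ∀ {i} → u ∼ v → N⁺ u ⊆ i → N⁺ v ⊆ i → ∃ λ w → u ⟶ w × v ⟶ w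
  outParts⇒commonOut (_ , w , _ , _ , inj₁ (u⟶w , inj₁ v⟶w)) _ _ = w , u⟶w , v⟶w
  outParts⇒commonOut (_ , w , _ , _ , inj₂ (v⟶w , inj₁ u⟶w)) _ _ = w , u⟶w , v⟶w
  outParts⇒commonOut (_ , w , _ , _ , inj₁ (u⟶w , inj₂ (z , _ , v⟶z , z⟶w))) u⊆ v⊆ =
    ⊥-elim (arc⇒part≢ z⟶w (trans (v⊆ z v⟶z) (sym (u⊆ w u⟶w))))
  outParts⇒commonOut (_ , w , _ , _ , inj₂ (v⟶w , inj₂ (z , _ , u⟶z , z⟶w))) u⊆ v⊆ =
    ⊥-elim (arc⇒part≢ z⟶w (trans (u⊆ z u⟶z) (sym (v⊆ w v⟶w))))

  ToEither : Fin n → Fin n → Fin n → Set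
  ToEither p q t = t ⟶ p ⊎ t ⟶ q

  OnlyOut : Fin n → Fin n → Set
  OnlyOut p q = ∀ w → p ⟶ w → w ≡ q

  toEither⇒≢ : p ⟶ q → ToEither p q t → t ≢ q
  toEither⇒≢ p⟶q (inj₁ q⟶p) refl = arc-asym p⟶q q⟶p
  toEither⇒≢ p⟶q (inj₂ q⟶q) refl = arc⇒≢ q⟶q refl

  toEither-∼ : p ⟶ q → t ≢ t′ → t ≢ p → t′ ≢ p → ToEither p q t → ToEither p q t′ → t ∼ t′
  toEither-∼ _ t≢t′ _ _ (inj₁ t⟶p) (inj₁ t′⟶p) = commonOut⇒∼ t≢t′ t⟶p t′⟶p
  toEither-∼ _ t≢t′ _ _ (inj₂ t⟶q) (inj₂ t′⟶q) = commonOut⇒∼ t≢t′ t⟶q t′⟶q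
  toEither-∼ p⟶q t≢t′ _ t′≢p (inj₁ t⟶p) (inj₂ t′⟶q) =
    ∼-sym (twoStep⇒∼ (≢-sym t≢t′) t′⟶q t⟶p p⟶q (≢-sym t′≢p) (≢-sym (toEither⇒≢ p⟶q (inj₁ t⟶p))))
  toEither-∼ p⟶q t≢t′ t≢p _ (inj₂ t⟶q) (inj₁ t′⟶p) =
    twoStep⇒∼ t≢t′ t⟶q t′⟶p p⟶q (≢-sym t≢p) (≢-sym (toEither⇒≢ p⟶q (inj₁ t′⟶p)))

  module NonAdjacentArc {p q : Fin n} (p⟶q : p ⟶ q) (p≁q : p ≁ q) where

    outParts≡ : p ⟶ w → w ≢ q → q ⟶ y → part w ≡ part y
    outParts≡ p⟶w w≢q q⟶y =
      ≁⇒outParts≡ p≁q (arc⇒≢ p⟶q) p⟶w q⟶y w≢q (λ { refl → arc-asym p⟶q q⟶y })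

    toEither : p ⟶ w → w ≢ q → q ⟶ y → t ≢ q → ToEither p q t
    toEither {t = t} p⟶w w≢q q⟶y t≢q with arc? t p | arc? t q
    ... | yes t⟶p | _       = inj₁ t⟶p
    ... | no _    | yes t⟶q = inj₂ t⟶q
    ... | no t↛p  | no t↛q with part t Fin.≟ part q
    ...   | yes same = ⊥-elim (arc⇒part≢ q⟶y (trans (sym same) (outParts≡ p⟶t t≢q q⟶y)))
      where
      p⟶t : p ⟶ t
      p⟶t = ¬arc⇒arc (λ t∈p → arc⇒part≢ p⟶q (trans (sym t∈p) same)) t↛p
    ...   | no other = ⊥-elim (p≁q (commonOut⇒∼ (arc⇒≢ p⟶q) p⟶t q⟶t))
      where
      q⟶t : q ⟶ t
      q⟶t = ¬arc⇒arc other t↛q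
      p⟶t : p ⟶ t
      p⟶t = ¬arc⇒arc (λ t∈p → arc⇒part≢ p⟶w (sym (trans (outParts≡ p⟶w w≢q q⟶t) t∈p))) t↛p

    onlyOut : q ⟶ y → u ≢ v → u ≢ p → u ≢ q → v ≢ p → v ≢ q → u ≁ v → OnlyOut p q
    onlyOut q⟶y u≢v u≢p u≢q v≢p v≢q u≁v w p⟶w with w Fin.≟ q
    ... | yes w≡q = w≡q
    ... | no w≢q  = ⊥-elim (u≁v (toEither-∼ p⟶q u≢v u≢p v≢p
                      (toEither p⟶w w≢q q⟶y u≢q) (toEither p⟶w w≢q q⟶y v≢q)))

  onlyOut-split : OnlyOut p q → p ⟶ q → t ≢ q → ToEither p q t ⊎ (part t ≡ part p × q ⟶ t)
  onlyOut-split {p} {q} {t} only p⟶q t≢q with part t Fin.≟ part p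
  ... | no other with arc-connex other
  ...   | inj₁ t⟶p = inj₁ (inj₁ t⟶p)
  ...   | inj₂ p⟶t = ⊥-elim (t≢q (only t p⟶t))
  onlyOut-split {p} {q} {t} only p⟶q t≢q | yes same
    with arc-connex (λ t∈q → arc⇒part≢ p⟶q (trans (sym same) t∈q))
  ...   | inj₁ t⟶q = inj₁ (inj₂ t⟶q)
  ...   | inj₂ q⟶t = inj₂ (same , q⟶t)

  onlyOut-toEither : OnlyOut p q → p ⟶ q → t ≢ q → ¬ q ⟶ t → ToEither p q t
  onlyOut-toEither only p⟶q t≢q q↛t with onlyOut-split only p⟶q t≢q
  ... | inj₁ e = e
  ... | inj₂ (_ , q⟶t) = ⊥-elim (q↛t q⟶t)

  -- Were q ⟶ t, then N⁺(q) = {t} as well, so u and v, not being out-neighbours of q, would both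
  -- dominate p or q and hence be adjacent.
  onlyOut-≁⇒toEither : p ⟶ q → OnlyOut p q → q ≁ t → t ⟶ y → t ≢ q →
                       u ≢ v → u ≢ p → u ≢ q → u ≢ t → v ≢ p → v ≢ q → v ≢ t → u ≁ v → ToEither p q t
  onlyOut-≁⇒toEither {p = p} {q = q} {t = t} p⟶q only q≁t t⟶y t≢q u≢v u≢p u≢q u≢t v≢p v≢q v≢t u≁v =
    onlyOut-toEither only p⟶q t≢q q↛t
    where
    q↛t : ¬ q ⟶ t
    q↛t q⟶t = u≁v (toEither-∼ p⟶q u≢v u≢p v≢p (into u≢q u≢t) (into v≢q v≢t))
      where
      only′ : OnlyOut q t
      only′ = NonAdjacentArc.onlyOut q⟶t q≁t t⟶y u≢v u≢q u≢t v≢q v≢t u≁v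
      into : ∀ {x} → x ≢ q → x ≢ t → ToEither p q x
      into x≢q x≢t = onlyOut-toEither only p⟶q x≢q (λ q⟶x → x≢t (only′ _ q⟶x))

  onlyOut-∼⇒N⁺⊈ : OnlyOut p q → p ∼ t → q ⟶ t → ¬ N⁺ t ⊆ part q
  onlyOut-∼⇒N⁺⊈ only (_ , w , _ , _ , inj₁ (p⟶w , inj₁ t⟶w)) q⟶t _
    with refl ← only w p⟶w = arc-asym q⟶t t⟶w
  onlyOut-∼⇒N⁺⊈ only (_ , w , _ , _ , inj₁ (p⟶w , inj₂ (z , _ , t⟶z , z⟶w))) _ t⊆
    with refl ← only w p⟶w = arc⇒part≢ z⟶w (t⊆ z t⟶z)
  onlyOut-∼⇒N⁺⊈ only (_ , w , _ , _ , inj₂ (t⟶w , inj₁ p⟶w)) q⟶t _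
    with refl ← only w p⟶w = arc-asym q⟶t t⟶w
  onlyOut-∼⇒N⁺⊈ only (_ , w , _ , _ , inj₂ (t⟶w , inj₂ (z , _ , p⟶z , z⟶w))) _ t⊆
    with refl ← only z p⟶z = arc⇒part≢ z⟶w (sym (t⊆ w t⟶w))

module Chords (D : MultipartiteTournament) where
  open MultipartiteTournament D
  open Arcs D

  private variable t a0 a1 a2 a3 a4 x0 x1 x2 x3 x4 x5 : Fin n

  record InducedC5 (a0 a1 a2 a3 a4 : Fin n) : Set where
    field
      ∼01 : a0 ∼ a1
      ∼12 : a1 ∼ a2
      ∼23 : a2 ∼ a3
      ∼34 : a3 ∼ a4
      ∼40 : a4 ∼ a0
      ≁02 : a0 ≁ a2
      ≁03 : a0 ≁ a3
      ≁13 : a1 ≁ a3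
      ≁14 : a1 ≁ a4
      ≁24 : a2 ≁ a4
      ≢02 : a0 ≢ a2
      ≢03 : a0 ≢ a3
      ≢13 : a1 ≢ a3
      ≢14 : a1 ≢ a4
      ≢24 : a2 ≢ a4

    ≢01 : a0 ≢ a1
    ≢01 = ∼⇒≢ ∼01
    ≢12 : a1 ≢ a2
    ≢12 = ∼⇒≢ ∼12
    ≢23 : a2 ≢ a3
    ≢23 = ∼⇒≢ ∼23
    ≢34 : a3 ≢ a4
    ≢34 = ∼⇒≢ ∼34
    ≢40 : a4 ≢ a0
    ≢40 = ∼⇒≢ ∼40

  rotate : InducedC5 a0 a1 a2 a3 a4 → InducedC5 a1 a2 a3 a4 a0
  rotate c = record
    { ∼01 = ∼12 ; ∼12 = ∼23 ; ∼23 = ∼34 ; ∼34 = ∼40 ; ∼40 = ∼01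
    ; ≁02 = ≁13 ; ≁03 = ≁14 ; ≁13 = ≁24 ; ≁14 = ≁-sym ≁02 ; ≁24 = ≁-sym ≁03
    ; ≢02 = ≢13 ; ≢03 = ≢14 ; ≢13 = ≢24 ; ≢14 = ≢-sym ≢02 ; ≢24 = ≢-sym ≢03 }
    where open InducedC5 c

  reflect : InducedC5 a0 a1 a2 a3 a4 → InducedC5 a0 a4 a3 a2 a1
  reflect c = record
    { ∼01 = ∼-sym ∼40 ; ∼12 = ∼-sym ∼34 ; ∼23 = ∼-sym ∼23 ; ∼34 = ∼-sym ∼12 ; ∼40 = ∼-sym ∼01
    ; ≁02 = ≁03 ; ≁03 = ≁02 ; ≁13 = ≁-sym ≁24 ; ≁14 = ≁-sym ≁14 ; ≁24 = ≁-sym ≁13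
    ; ≢02 = ≢03 ; ≢03 = ≢02 ; ≢13 = ≢-sym ≢24 ; ≢14 = ≢-sym ≢14 ; ≢24 = ≢-sym ≢13 }
    where open InducedC5 c

  module C5Chord {a0 a1 a2 a3 a4 : Fin n} (c : InducedC5 a0 a1 a2 a3 a4) (a0⟶a2 : a0 ⟶ a2) where
    open InducedC5 c

    onlyOut : OnlyOut a0 a2
    onlyOut = NonAdjacentArc.onlyOut a0⟶a2 ≁02 (proj₂ (∼⇒out ∼23))
                ≢13 (≢-sym ≢01) ≢12 (≢-sym ≢03) (≢-sym ≢23) ≁13

    toEither₄ : ToEither a0 a2 a4
    toEither₄ = onlyOut-≁⇒toEither a0⟶a2 onlyOut ≁24 (proj₂ (∼⇒out ∼40)) (≢-sym ≢24)
                  ≢13 (≢-sym ≢01) ≢12 ≢14 (≢-sym ≢03) (≢-sym ≢23) ≢34 ≁13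

    backArc₁ : part a1 ≡ part a0 × a2 ⟶ a1
    backArc₁ with onlyOut-split onlyOut a0⟶a2 ≢12
    ... | inj₂ r  = r
    ... | inj₁ e₁ = ⊥-elim (≁14 (toEither-∼ a0⟶a2 ≢14 (≢-sym ≢01) ≢40 e₁ toEither₄))

  c5-chord-N⁺⊆-via₂ : InducedC5 a0 a1 a2 a3 a4 → a0 ⟶ a2 → a4 ⟶ a2 → N⁺ a1 ⊆ part a2
  c5-chord-N⁺⊆-via₂ {a0} {a1} {a2} {a3} {a4} c a0⟶a2 a4⟶a2 w a1⟶w =
    part≡-≁⇒outParts≡ part14 ≁14 ≢14 a1⟶w a4⟶a2
    where
    open InducedC5 c
    open C5Chord c a0⟶a2
    part34 : part a3 ≡ part a4
    part34 = proj₁ (C5Chord.backArc₁ (rotate (reflect c)) a4⟶a2)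
    part03 : part a0 ≡ part a3
    part03 = ¬arcs⇒part≡ (λ a0⟶a3 → ≢23 (sym (onlyOut a3 a0⟶a3)))
      (λ a3⟶a0 → ≢24 (sym (onlyOut a4 (proj₂ (C5Chord.backArc₁ (rotate (rotate (rotate c))) a3⟶a0)))))
    part14 : part a1 ≡ part a4
    part14 = trans (proj₁ backArc₁) (trans part03 part34)

  c5-chord-N⁺⊆-via₀ : InducedC5 a0 a1 a2 a3 a4 → a0 ⟶ a2 → a4 ⟶ a0 → N⁺ a1 ⊆ part a2
  c5-chord-N⁺⊆-via₀ {a0} {a1} {a2} {a3} {a4} c a0⟶a2 a4⟶a0 =
    split₃ (onlyOut-split onlyOut a0⟶a2 (≢-sym ≢23))
    where
    open InducedC5 c
    open C5Chord c a0⟶a2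
    split₃ : ToEither a0 a2 a3 ⊎ (part a3 ≡ part a0 × a2 ⟶ a3) → N⁺ a1 ⊆ part a2
    split₃ (inj₁ (inj₁ a3⟶a0)) =
      ⊥-elim (arc-asym a4⟶a0 (proj₂ (C5Chord.backArc₁ (rotate (rotate (rotate c))) a3⟶a0)))
    split₃ (inj₁ (inj₂ a3⟶a2)) = ⊥-elim (≁⇒¬commonOut ≁03 ≢03 a0⟶a2 a3⟶a2)
    split₃ (inj₂ (part30 , _)) =
      split₁₄ (arc-connex (λ e → arc⇒part≢ a4⟶a0 (trans (sym e) (proj₁ backArc₁))))
      where
      part42 : a1 ⟶ a4 → ∃ (a3 ⟶_) → part a4 ≡ part a2
      part42 a1⟶a4 (_ , a3⟶y) =
        trans (part≡-≁⇒outParts≡ (trans (proj₁ backArc₁) (sym part30)) ≁13 ≢13 a1⟶a4 a3⟶y)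
              (sym (part≡-≁⇒outParts≡ (sym part30) ≁03 ≢03 a0⟶a2 a3⟶y))
      split₁₄ : a1 ⟶ a4 ⊎ a4 ⟶ a1 → N⁺ a1 ⊆ part a2
      split₁₄ (inj₁ a1⟶a4) w a1⟶w = trans (cong part (only14 w a1⟶w)) (part42 a1⟶a4 (∼⇒out ∼34))
        where
        only14 : OnlyOut a1 a4
        only14 = NonAdjacentArc.onlyOut a1⟶a4 ≁14 (proj₂ (∼⇒out ∼40))
                   ≢02 ≢01 (≢-sym ≢40) (≢-sym ≢12) ≢24 ≁02
      split₁₄ (inj₂ a4⟶a1) = ⊥-elim (≢01 (only41 a0 a4⟶a0))
        where
        only41 : OnlyOut a4 a1
        only41 = NonAdjacentArc.onlyOut a4⟶a1 (≁-sym ≁14) (proj₂ (∼⇒out ∼12))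
                   ≢02 (≢-sym ≢40) ≢01 ≢24 (≢-sym ≢12) ≁02

  c5-¬chord : InducedC5 a0 a1 a2 a3 a4 → ¬ a0 ⟶ a2
  c5-¬chord {a0} {a1} {a2} {a3} {a4} c a0⟶a2 =
    onlyOut-∼⇒N⁺⊈ onlyOut ∼01 (proj₂ backArc₁) (N⁺₁⊆ toEither₄)
    where
    open InducedC5 c
    open C5Chord c a0⟶a2
    N⁺₁⊆ : ToEither a0 a2 a4 → N⁺ a1 ⊆ part a2
    N⁺₁⊆ (inj₁ a4⟶a0) = c5-chord-N⁺⊆-via₀ c a0⟶a2 a4⟶a0
    N⁺₁⊆ (inj₂ a4⟶a2) = c5-chord-N⁺⊆-via₂ c a0⟶a2 a4⟶a2

  -- Six consecutive vertices of a hole of length at least 6: x0 ∼ x5 is left open.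
  record Window6 (x0 x1 x2 x3 x4 x5 : Fin n) : Set where
    field
      ∼01 : x0 ∼ x1
      ∼12 : x1 ∼ x2
      ∼23 : x2 ∼ x3
      ∼34 : x3 ∼ x4
      ∼45 : x4 ∼ x5
      ≁02 : x0 ≁ x2
      ≁13 : x1 ≁ x3
      ≁24 : x2 ≁ x4
      ≁35 : x3 ≁ x5
      ≁03 : x0 ≁ x3
      ≁14 : x1 ≁ x4
      ≁25 : x2 ≁ x5
      ≁04 : x0 ≁ x4
      ≁15 : x1 ≁ x5
      ≢02 : x0 ≢ x2
      ≢13 : x1 ≢ x3
      ≢24 : x2 ≢ x4
      ≢35 : x3 ≢ x5
      ≢03 : x0 ≢ x3
      ≢14 : x1 ≢ x4
      ≢25 : x2 ≢ x5
      ≢04 : x0 ≢ x4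
      ≢15 : x1 ≢ x5
      ≢05 : x0 ≢ x5

    ≢01 : x0 ≢ x1
    ≢01 = ∼⇒≢ ∼01
    ≢12 : x1 ≢ x2
    ≢12 = ∼⇒≢ ∼12
    ≢23 : x2 ≢ x3
    ≢23 = ∼⇒≢ ∼23
    ≢34 : x3 ≢ x4
    ≢34 = ∼⇒≢ ∼34
    ≢45 : x4 ≢ x5
    ≢45 = ∼⇒≢ ∼45

  reverse : Window6 x0 x1 x2 x3 x4 x5 → Window6 x5 x4 x3 x2 x1 x0
  reverse w = record
    { ∼01 = ∼-sym ∼45 ; ∼12 = ∼-sym ∼34 ; ∼23 = ∼-sym ∼23 ; ∼34 = ∼-sym ∼12 ; ∼45 = ∼-sym ∼01
    ; ≁02 = ≁-sym ≁35 ; ≁13 = ≁-sym ≁24 ; ≁24 = ≁-sym ≁13 ; ≁35 = ≁-sym ≁02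
    ; ≁03 = ≁-sym ≁25 ; ≁14 = ≁-sym ≁14 ; ≁25 = ≁-sym ≁03 ; ≁04 = ≁-sym ≁15 ; ≁15 = ≁-sym ≁04
    ; ≢02 = ≢-sym ≢35 ; ≢13 = ≢-sym ≢24 ; ≢24 = ≢-sym ≢13 ; ≢35 = ≢-sym ≢02
    ; ≢03 = ≢-sym ≢25 ; ≢14 = ≢-sym ≢14 ; ≢25 = ≢-sym ≢03
    ; ≢04 = ≢-sym ≢15 ; ≢15 = ≢-sym ≢04 ; ≢05 = ≢-sym ≢05 }
    where open Window6 w

  module W6Chord₂ {x0 x1 x2 x3 x4 x5 : Fin n} (w : Window6 x0 x1 x2 x3 x4 x5) (x1⟶x3 : x1 ⟶ x3) where
    open Window6 w

    onlyOut : OnlyOut x1 x3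
    onlyOut = NonAdjacentArc.onlyOut x1⟶x3 ≁13 (proj₂ (∼⇒out ∼34))
                ≢24 (≢-sym ≢12) ≢23 (≢-sym ≢14) (≢-sym ≢34) ≁24

    toEither : x3 ≁ t → ∃ (t ⟶_) → t ≢ x3 → x2 ≢ t → x4 ≢ t → ToEither x1 x3 t
    toEither x3≁t (_ , t⟶y) t≢x3 x2≢t x4≢t = onlyOut-≁⇒toEither x1⟶x3 onlyOut x3≁t t⟶y t≢x3
      ≢24 (≢-sym ≢12) ≢23 x2≢t (≢-sym ≢14) (≢-sym ≢34) x4≢t ≁24

    toEither₀ : ToEither x1 x3 x0
    toEither₀ = toEither (≁-sym ≁03) (∼⇒out ∼01) ≢03 (≢-sym ≢02) (≢-sym ≢04)

    toEither₅ : ToEither x1 x3 x5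
    toEither₅ = toEither ≁35 (∼⇒out (∼-sym ∼45)) (≢-sym ≢35) ≢25 ≢45

    backArc₂ : x3 ⟶ x2
    backArc₂ with onlyOut-split onlyOut x1⟶x3 ≢23
    ... | inj₂ (_ , x3⟶x2) = x3⟶x2
    ... | inj₁ e₂ = ⊥-elim (≁02 (toEither-∼ x1⟶x3 ≢02 ≢01 (≢-sym ≢12) toEither₀ e₂))

  w6-¬chord₂ : Window6 x0 x1 x2 x3 x4 x5 → x0 ≁ x5 → ¬ x1 ⟶ x3
  w6-¬chord₂ w x0≁x5 x1⟶x3 = x0≁x5 (toEither-∼ x1⟶x3 ≢05 ≢01 (≢-sym ≢15) toEither₀ toEither₅)
    where
    open Window6 w
    open W6Chord₂ w x1⟶x3

  -- For a hole of length 6, where x0 ∼ x5; the window x4 … x3 supplies the hypothesis.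
  w6-¬chord₂-wrap : Window6 x0 x1 x2 x3 x4 x5 → (x5 ⟶ x1 → x1 ⟶ x0) → ¬ x1 ⟶ x3
  w6-¬chord₂-wrap w wrap x1⟶x3 with W6Chord₂.toEither₅ w x1⟶x3
  ... | inj₁ x5⟶x1 = Window6.≢03 w (W6Chord₂.onlyOut w x1⟶x3 _ (wrap x5⟶x1))
  ... | inj₂ x5⟶x3 = Window6.≁15 w (commonOut⇒∼ (Window6.≢15 w) x1⟶x3 x5⟶x3)

  w6-¬chord₃ : Window6 x0 x1 x2 x3 x4 x5 → ¬ x1 ⟶ x4
  w6-¬chord₃ {x0} {x1} {x2} {x3} {x4} {x5} w x1⟶x4 =
    ≁02 (toEither-∼ x1⟶x4 ≢02 ≢01 (≢-sym ≢12)
      (toEither (≁-sym ≁04) (∼⇒out ∼01) ≢04 (≢-sym ≢03) (≢-sym ≢05))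
      (toEither (≁-sym ≁24) (∼⇒out ∼23) ≢24 (≢-sym ≢23) (≢-sym ≢25)))
    where
    open Window6 w
    onlyOut : OnlyOut x1 x4
    onlyOut = NonAdjacentArc.onlyOut x1⟶x4 ≁14 (proj₂ (∼⇒out (∼-sym ∼34)))
                ≢02 ≢01 ≢04 (≢-sym ≢12) ≢24 ≁02
    toEither : x4 ≁ t → ∃ (t ⟶_) → t ≢ x4 → x3 ≢ t → x5 ≢ t → ToEither x1 x4 t
    toEither x4≁t (_ , t⟶y) t≢x4 x3≢t x5≢t = onlyOut-≁⇒toEither x1⟶x4 onlyOut x4≁t t⟶y t≢x4
      ≢35 (≢-sym ≢13) ≢34 x3≢t (≢-sym ≢15) (≢-sym ≢45) x5≢t ≁35

module HoleIndexing (D : MultipartiteTournament) (L : Hole D) where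
  open MultipartiteTournament D
  open Arcs D
  open Hole L

  1<len : 1 < len
  1<len = ≤-trans (s≤s (s≤s z≤n)) len≥4

  instance
    len-nonZero : NonZero len
    len-nonZero = >-nonZero (<-trans (s≤s z≤n) 1<len)

  [d+i]%≡[d+i%]% : ∀ d i → d < len → (d + i) % len ≡ (d + i % len) % len
  [d+i]%≡[d+i%]% d i d<len =
    trans (%-distribˡ-+ d i len) (cong (λ x → (x + i % len) % len) (m<n⇒m%n≡m d<len))

  [d+r]%≢r : ∀ {d r} → 0 < d → d < len → r < len → (d + r) % len ≢ r
  [d+r]%≢r {d} {r} 0<d d<len r<len eq with d + r <? len
  ... | yes d+r<len = <⇒≢ (m<n+m r 0<d) (sym (trans (sym (m<n⇒m%n≡m d+r<len)) eq))
  ... | no d+r≮len  = <⇒≢ wrapped<r (trans (sym wrapped) eq)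
    where
    len≤d+r : len ≤ d + r
    len≤d+r = ≮⇒≥ d+r≮len
    wrapped<r : d + r ∸ len < r
    wrapped<r = subst (d + r ∸ len <_) (m+n∸m≡n len r) (∸-monoˡ-< (+-monoˡ-< r d<len) len≤d+r)
    wrapped : (d + r) % len ≡ d + r ∸ len
    wrapped = trans (sym (m≤n⇒[n∸m]%m≡n%m len≤d+r)) (m<n⇒m%n≡m (<-trans wrapped<r r<len))

  pos : ℕ → Fin len
  pos i = fromℕ< (m%n<n i len)

  toℕ-pos : ∀ i → toℕ (pos i) ≡ i % len
  toℕ-pos i = Fin.toℕ-fromℕ< (m%n<n i len)

  pos-≢ : ∀ d i → 0 < d → d < len → pos (d + i) ≢ pos i
  pos-≢ d i 0<d d<len eq = [d+r]%≢r 0<d d<len (m%n<n i len) (begin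
    (d + i % len) % len  ≡⟨ sym ([d+i]%≡[d+i%]% d i d<len) ⟩
    (d + i) % len        ≡⟨ sym (toℕ-pos (d + i)) ⟩
    toℕ (pos (d + i))    ≡⟨ cong toℕ eq ⟩
    toℕ (pos i)          ≡⟨ toℕ-pos i ⟩
    i % len              ∎)
    where open ≡-Reasoning

  pos-periodic : ∀ i → pos (len + i) ≡ pos i
  pos-periodic i = Fin.toℕ-injective (begin
    toℕ (pos (len + i))  ≡⟨ toℕ-pos (len + i) ⟩
    (len + i) % len      ≡⟨ cong (_% len) (+-comm len i) ⟩
    (i + len) % len      ≡⟨ [m+n]%n≡m%n i len ⟩
    i % len              ≡⟨ sym (toℕ-pos i) ⟩
    toℕ (pos i)          ∎)
    where open ≡-Reasoning

  pos-toℕ : ∀ j → pos (toℕ j) ≡ j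
  pos-toℕ j = Fin.toℕ-injective (trans (toℕ-pos (toℕ j)) (m<n⇒m%n≡m (Fin.toℕ<n j)))

  pos-succ : ∀ i → Succ D len (pos i) (pos (suc i))
  pos-succ i with suc (i % len) <? len
  ... | yes 1+r<len = inj₁ (begin
    toℕ (pos (suc i))    ≡⟨ toℕ-pos (suc i) ⟩
    suc i % len          ≡⟨ [d+i]%≡[d+i%]% 1 i 1<len ⟩
    suc (i % len) % len  ≡⟨ m<n⇒m%n≡m 1+r<len ⟩
    suc (i % len)        ≡⟨ cong suc (sym (toℕ-pos i)) ⟩
    suc (toℕ (pos i))    ∎)
    where open ≡-Reasoning
  ... | no 1+r≮len = inj₂ (trans (cong suc (toℕ-pos i)) 1+r≡len , (begin
    toℕ (pos (suc i))    ≡⟨ toℕ-pos (suc i) ⟩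
    suc i % len          ≡⟨ [d+i]%≡[d+i%]% 1 i 1<len ⟩
    suc (i % len) % len  ≡⟨ cong (_% len) 1+r≡len ⟩
    len % len            ≡⟨ n%n≡0 len ⟩
    0                    ∎))
    where
    open ≡-Reasoning
    1+r≡len : suc (i % len) ≡ len
    1+r≡len = ≤-antisym (m%n<n i len) (≮⇒≥ 1+r≮len)

  succ-unique : ∀ {j l l′} → Succ D len j l → Succ D len j l′ → l ≡ l′
  succ-unique (inj₁ l≡) (inj₁ l′≡) = Fin.toℕ-injective (trans l≡ (sym l′≡))
  succ-unique {l = l} (inj₁ l≡) (inj₂ (last , _)) = ⊥-elim (<⇒≢ (Fin.toℕ<n l) (trans l≡ last))
  succ-unique {l′ = l′} (inj₂ (last , _)) (inj₁ l′≡) = ⊥-elim (<⇒≢ (Fin.toℕ<n l′) (trans l′≡ last))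
  succ-unique (inj₂ (_ , l≡0)) (inj₂ (_ , l′≡0)) = Fin.toℕ-injective (trans l≡0 (sym l′≡0))

  V : ℕ → Fin n
  V i = vtx (pos i)

  V-periodic : ∀ i → V (len + i) ≡ V i
  V-periodic i = cong vtx (pos-periodic i)

  vtx≡V : ∀ j → vtx j ≡ V (toℕ j)
  vtx≡V j = cong vtx (sym (pos-toℕ j))

  V-distinct : ∀ i d → suc d < len → V i ≢ V (suc d + i)
  V-distinct i d d<len eq = pos-≢ (suc d) i (s≤s z≤n) d<len (sym (distinct eq))

  V-adjacent : ∀ i → V i ∼ V (suc i)
  V-adjacent i = Equivalence.from (induced (pos i) (pos (suc i)) pos≢)  (inj₁ (pos-succ i))
    where
    pos≢ : pos i ≢ pos (suc i)
    pos≢ eq = pos-≢ 1 i (s≤s z≤n) 1<len (sym eq)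

  V-nonadjacent : ∀ i d → 3 + d < len → V i ≁ V (2 + d + i)
  V-nonadjacent i d 3+d<len Vi∼ with pos i Fin.≟ pos (2 + d + i)
  ... | yes eq  = ∼⇒≢ Vi∼ (cong vtx eq)
  ... | no pos≢ with Equivalence.to (induced _ _ pos≢) Vi∼
  ...   | inj₁ forward  = pos-≢ (suc d) (suc i) (s≤s z≤n) (≤-trans (n≤1+n _) (<⇒≤ 3+d<len))
      (trans (cong (λ x → pos (suc x)) (+-suc d i)) (succ-unique forward (pos-succ i)))
  ...   | inj₂ backward = pos-≢ (3 + d) i (s≤s z≤n) 3+d<len
      (sym (succ-unique backward (pos-succ (2 + d + i))))

HasOutPart : (D : MultipartiteTournament) → Hole D → Fin (MultipartiteTournament.k D) → Set
HasOutPart D L X = ∃ λ Y → Y ≢ X × partSize D Y ≥ Hole.len L ×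
                   (∀ j → OutInto D Y (Hole.vtx L j)) × (∀ v → OutInto D Y v → InPart D X v)

module LongHole (D : MultipartiteTournament) (L : Hole D) (len≥5 : Hole.len L ≥ 5) where
  open MultipartiteTournament D
  open Arcs D
  open Hole L
  open Chords D
  open HoleIndexing D L

  ≁₂ : ∀ i → V i ≁ V (2 + i)
  ≁₂ i = V-nonadjacent i 0 len≥4

  ≁₃ : ∀ i → V i ≁ V (3 + i)
  ≁₃ i = V-nonadjacent i 1 len≥5

  ≢₂ : ∀ i → V i ≢ V (2 + i)
  ≢₂ i = V-distinct i 1 (≤-trans (n≤1+n 3) len≥4)

  ≢₃ : ∀ i → V i ≢ V (3 + i)
  ≢₃ i = V-distinct i 2 len≥4

  ≢₄ : ∀ i → V i ≢ V (4 + i)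
  ≢₄ i = V-distinct i 3 len≥5

  pentagon : len ≡ 5 → ∀ c → InducedC5 (V c) (V (1 + c)) (V (2 + c)) (V (3 + c)) (V (4 + c))
  pentagon len≡5 c = record
    { ∼01 = V-adjacent c ; ∼12 = V-adjacent (1 + c) ; ∼23 = V-adjacent (2 + c) ; ∼34 = V-adjacent (3 + c)
    ; ∼40 = subst (V (4 + c) ∼_) (subst (λ m → V (m + c) ≡ V c) len≡5 (V-periodic c))
                  (V-adjacent (4 + c))
    ; ≁02 = ≁₂ c ; ≁03 = ≁₃ c ; ≁13 = ≁₂ (1 + c) ; ≁14 = ≁₃ (1 + c) ; ≁24 = ≁₂ (2 + c)
    ; ≢02 = ≢₂ c ; ≢03 = ≢₃ c ; ≢13 = ≢₂ (1 + c) ; ≢14 = ≢₃ (1 + c) ; ≢24 = ≢₂ (2 + c) }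

  window : 6 ≤ len → ∀ c → Window6 (V c) (V (1 + c)) (V (2 + c)) (V (3 + c)) (V (4 + c)) (V (5 + c))
  window 6≤len c = record
    { ∼01 = V-adjacent c ; ∼12 = V-adjacent (1 + c) ; ∼23 = V-adjacent (2 + c)
    ; ∼34 = V-adjacent (3 + c) ; ∼45 = V-adjacent (4 + c)
    ; ≁02 = ≁₂ c ; ≁13 = ≁₂ (1 + c) ; ≁24 = ≁₂ (2 + c) ; ≁35 = ≁₂ (3 + c)
    ; ≁03 = ≁₃ c ; ≁14 = ≁₃ (1 + c) ; ≁25 = ≁₃ (2 + c)
    ; ≁04 = V-nonadjacent c 2 6≤len ; ≁15 = V-nonadjacent (1 + c) 2 6≤len
    ; ≢02 = ≢₂ c ; ≢13 = ≢₂ (1 + c) ; ≢24 = ≢₂ (2 + c) ; ≢35 = ≢₂ (3 + c)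
    ; ≢03 = ≢₃ c ; ≢14 = ≢₃ (1 + c) ; ≢25 = ≢₃ (2 + c)
    ; ≢04 = ≢₄ c ; ≢15 = ≢₄ (1 + c) ; ≢05 = V-distinct c 4 6≤len }

  -- Offset 1 + b leaves room for the window V b … V (5 + b) around the chords.
  record ChordFree (b : ℕ) : Set where
    field
      ¬13 : ¬ V (1 + b) ⟶ V (3 + b)
      ¬42 : ¬ V (4 + b) ⟶ V (2 + b)
      ¬14 : ¬ V (1 + b) ⟶ V (4 + b)
      ¬41 : ¬ V (4 + b) ⟶ V (1 + b)

  chordFree₂ : 6 ≤ len → ∀ b → ¬ V (1 + b) ⟶ V (3 + b) × ¬ V (4 + b) ⟶ V (2 + b)
  chordFree₂ 6≤len b with m≤n⇒m<n∨m≡n 6≤len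
  ... | inj₁ 7≤len = w6-¬chord₂ (window 6≤len b) (V-nonadjacent b 3 7≤len)
                   , w6-¬chord₂ (reverse (window 6≤len b)) (≁-sym (V-nonadjacent b 3 7≤len))
  ... | inj₂ 6≡len = w6-¬chord₂-wrap (window 6≤len b) wrap₁
                   , w6-¬chord₂-wrap (reverse (window 6≤len b)) wrap₂
    where
    period : ∀ c → V (6 + c) ≡ V c
    period c = subst (λ m → V (m + c) ≡ V c) (sym 6≡len) (V-periodic c)
    wrap₁ : V (5 + b) ⟶ V (1 + b) → V (1 + b) ⟶ V b
    wrap₁ V5⟶V1 = subst₂ _⟶_ (period (1 + b)) (period b)
      (W6Chord₂.backArc₂ (window 6≤len (4 + b)) (subst (V (5 + b) ⟶_) (sym (period (1 + b))) V5⟶V1))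
    wrap₂ : V b ⟶ V (4 + b) → V (4 + b) ⟶ V (5 + b)
    wrap₂ V0⟶V4 =
      W6Chord₂.backArc₂ (reverse (window 6≤len (2 + b))) (subst (_⟶ V (4 + b)) (sym (period b)) V0⟶V4)

  chordFree : ∀ b → ChordFree b
  chordFree b with m≤n⇒m<n∨m≡n len≥5
  ... | inj₂ 5≡len = record
    { ¬13 = c5-¬chord (pentagon (sym 5≡len) (1 + b))
    ; ¬42 = c5-¬chord (rotate (rotate (rotate (reflect (pentagon (sym 5≡len) (2 + b))))))
    ; ¬14 = c5-¬chord (reflect (pentagon (sym 5≡len) (1 + b)))
    ; ¬41 = c5-¬chord (rotate (rotate (rotate (pentagon (sym 5≡len) (1 + b))))) }
  ... | inj₁ 6≤len = record
    { ¬13 = proj₁ (chordFree₂ 6≤len b)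
    ; ¬42 = proj₂ (chordFree₂ 6≤len b)
    ; ¬14 = w6-¬chord₃ (window 6≤len b)
    ; ¬41 = w6-¬chord₃ (reverse (window 6≤len b)) }

  consecutive-part≡ : ∀ b → part (V (1 + b)) ≡ part (V (2 + b))
  consecutive-part≡ b =
    trans (¬arcs⇒part≡ ¬14 ¬41) (sym (¬arcs⇒part≡ (ChordFree.¬13 (chordFree (1 + b))) ¬42))
    where open ChordFree (chordFree b)

  X : Fin k
  X = part (V 1)

  V∈X-suc : ∀ i → part (V (suc i)) ≡ X
  V∈X-suc zero    = refl
  V∈X-suc (suc i) = trans (sym (consecutive-part≡ i)) (V∈X-suc i)

  V∈X : ∀ i → part (V i) ≡ X
  V∈X (suc i) = V∈X-suc i
  V∈X zero    = begin
    part (V 0)                ≡⟨ cong part (sym (V-periodic 0)) ⟩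
    part (V (len + 0))        ≡⟨ cong (λ m → part (V m)) (trans (+-identityʳ len) (sym (suc-pred len))) ⟩
    part (V (suc (pred len))) ≡⟨ V∈X-suc (pred len) ⟩
    X                         ∎
    where open ≡-Reasoning

  V-outParts≡ : ∀ {i j a b} → V i ≁ V j → V i ≢ V j → V i ⟶ a → V j ⟶ b → part a ≡ part b
  V-outParts≡ {i} {j} = part≡-≁⇒outParts≡ (trans (V∈X i) (sym (V∈X j)))

  outParts-step : ∀ i {a b} → V i ⟶ a → V (suc i) ⟶ b → part a ≡ part b
  outParts-step i Vi⟶a Vi+1⟶b with ∼⇒out (V-adjacent (3 + i))
  ... | _ , Vi+3⟶y = trans (V-outParts≡ (≁₃ i) (≢₃ i) Vi⟶a Vi+3⟶y)
                       (sym (V-outParts≡ (≁₂ (suc i)) (≢₂ (suc i)) Vi+1⟶b Vi+3⟶y))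

  out₀ : ∃ (V 0 ⟶_)
  out₀ = ∼⇒out (V-adjacent 0)

  Y : Fin k
  Y = part (proj₁ out₀)

  Y≢X : Y ≢ X
  Y≢X Y≡X = arc⇒part≢ (proj₂ out₀) (trans (V∈X 0) (sym Y≡X))

  N⁺V⊆Y : ∀ i → N⁺ V i ⊆ Y
  N⁺V⊆Y zero w V0⟶w with ∼⇒out (V-adjacent 1)
  ... | _ , V1⟶b = trans (outParts-step 0 V0⟶w V1⟶b) (sym (outParts-step 0 (proj₂ out₀) V1⟶b))
  N⁺V⊆Y (suc i) w Vi+1⟶w with ∼⇒out (V-adjacent i)
  ... | z , Vi⟶z = trans (sym (outParts-step i Vi⟶z Vi+1⟶w)) (N⁺V⊆Y i z Vi⟶z)

  commonOut : ∀ i → ∃ λ w → V i ⟶ w × V (suc i) ⟶ w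
  commonOut i = outParts⇒commonOut (V-adjacent i) (N⁺V⊆Y i) (N⁺V⊆Y (suc i))

  hub : ℕ → Fin n
  hub i = proj₁ (commonOut i)

  V-¬commonOut : ∀ i d {w} → 3 + d < len → V i ⟶ w → ¬ V (2 + d + i) ⟶ w
  V-¬commonOut i d 3+d<len =
    ≁⇒¬commonOut (V-nonadjacent i d 3+d<len) (V-distinct i (suc d) (<⇒≤ 3+d<len))

  hubs-disjoint : ∀ i d {w} → 0 < d → d < len →
                  V i ⟶ w → V (suc i) ⟶ w → V (d + i) ⟶ w → V (suc (d + i)) ⟶ w → ⊥
  hubs-disjoint i 1 _ _ Vi⟶w _ _ Vi+2⟶w = V-¬commonOut i 0 len≥4 Vi⟶w Vi+2⟶w
  hubs-disjoint i 2 _ _ Vi⟶w _ Vi+2⟶w _ = V-¬commonOut i 0 len≥4 Vi⟶w Vi+2⟶w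
  hubs-disjoint i (suc (suc (suc e))) {w} _ d<len _ Vi+1⟶w Vi+d⟶w _ =
    V-¬commonOut (suc i) e d<len Vi+1⟶w (subst (λ x → V (suc (suc x)) ⟶ w) (sym (+-suc e i)) Vi+d⟶w)

  hub-distinct : ∀ {a b} → a < b → b < len → hub a ≢ hub b
  hub-distinct {a} {b} a<b b<len eq =
    hubs-disjoint a (b ∸ a) (m<n⇒0<n∸m a<b) (≤-trans (s≤s (m∸n≤m b a)) b<len) Va⟶ Va+1⟶
      (subst (λ x → V x ⟶ hub a) (sym b∸a+a≡b) (subst (V b ⟶_) (sym eq) Vb⟶))
      (subst (λ x → V (suc x) ⟶ hub a) (sym b∸a+a≡b) (subst (V (suc b) ⟶_) (sym eq) Vb+1⟶))
    where
    b∸a+a≡b : b ∸ a + a ≡ b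
    b∸a+a≡b = m∸n+n≡m (<⇒≤ a<b)
    Va⟶ : V a ⟶ hub a
    Va⟶ = proj₁ (proj₂ (commonOut a))
    Va+1⟶ : V (suc a) ⟶ hub a
    Va+1⟶ = proj₂ (proj₂ (commonOut a))
    Vb⟶ : V b ⟶ hub b
    Vb⟶ = proj₁ (proj₂ (commonOut b))
    Vb+1⟶ : V (suc b) ⟶ hub b
    Vb+1⟶ = proj₂ (proj₂ (commonOut b))

  hub-injective : Injective _≡_ _≡_ (λ (j : Fin len) → hub (toℕ j))
  hub-injective {j} {j′} eq with <-cmp (toℕ j) (toℕ j′)
  ... | tri< j<j′ _ _ = ⊥-elim (hub-distinct j<j′ (Fin.toℕ<n j′) eq)
  ... | tri≈ _ j≡j′ _ = Fin.toℕ-injective j≡j′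
  ... | tri> _ _ j′<j = ⊥-elim (hub-distinct j′<j (Fin.toℕ<n j) (sym eq))

  outInto⇒X : ∀ v → OutInto D Y v → InPart D X v
  outInto⇒X v ((w , v⟶w) , N⁺v⊆Y) with part v Fin.≟ X
  ... | yes v∈X = v∈X
  ... | no v∉X with arc-connex (λ e → v∉X (trans e (V∈X 0)))
  ...   | inj₁ v⟶V0 = ⊥-elim (Y≢X (trans (sym (N⁺v⊆Y (V 0) v⟶V0)) (V∈X 0)))
  ...   | inj₂ V0⟶v = ⊥-elim (arc⇒part≢ v⟶w (trans (N⁺V⊆Y 0 v V0⟶v) (sym (N⁺v⊆Y w v⟶w))))

  hub∈Y : ∀ i → part (hub i) ≡ Y
  hub∈Y i = N⁺V⊆Y i (hub i) (proj₁ (proj₂ (commonOut i)))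

  hasOutPart : HasOutPart D L X
  hasOutPart = Y , Y≢X
             , injective⇒≤partSize _ hub-injective (λ j → hub∈Y (toℕ j))
             , (λ j → subst (OutInto D Y) (sym (vtx≡V j)) (∼⇒out (V-adjacent (toℕ j)) , N⁺V⊆Y (toℕ j)))
             , outInto⇒X

  ¬competing-X : ¬ Competing D X
  ¬competing-X competing = ≁₂ 0 (competing (V 0) (V 2) (V∈X 0) (V∈X 2) (≢₂ 0))

  Side : Fin n → Fin n → ℕ → Set
  Side t t′ j = V j ⟶ t ⊎ V j ⟶ t′

  -- Non-adjacent hole vertices have no common out-neighbour, and V 0, V 2, V 4, V 1, V 3 is an odd
  -- cycle of non-adjacent pairs, so the sides cannot alternate around it.
  ¬alternating : ∀ {t t′} → V 0 ⟶ t → Side t t′ 1 → Side t t′ 2 → Side t t′ 3 → Side t t′ 4 → ⊥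
  ¬alternating {t} {t′} V0⟶t s₁ s₂ s₃ s₄ = ≁⇒¬commonOut (≁₃ 0) (≢₃ 0) V0⟶t V3⟶t
    where
    other : ∀ {i j x x′} → V i ≁ V j → V i ≢ V j → V i ⟶ x → V j ⟶ x ⊎ V j ⟶ x′ → V j ⟶ x′
    other Vi≁Vj Vi≢Vj Vi⟶x (inj₁ Vj⟶x)  = ⊥-elim (≁⇒¬commonOut Vi≁Vj Vi≢Vj Vi⟶x Vj⟶x)
    other _ _ _ (inj₂ Vj⟶x′) = Vj⟶x′
    V2⟶t′ : V 2 ⟶ t′
    V2⟶t′ = other (≁₂ 0) (≢₂ 0) V0⟶t s₂
    V4⟶t : V 4 ⟶ t
    V4⟶t = other (≁₂ 2) (≢₂ 2) V2⟶t′ (swap s₄)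
    V1⟶t′ : V 1 ⟶ t′
    V1⟶t′ = other (≁-sym (≁₃ 1)) (≢-sym (≢₃ 1)) V4⟶t s₁
    V3⟶t : V 3 ⟶ t
    V3⟶t = other (≁₂ 1) (≢₂ 1) V1⟶t′ (swap s₃)

  competing-others : ∀ i → i ≢ X → Competing D i
  competing-others i i≢X u v u∈i v∈i u≢v = firstAdj (side 0) (side 1) (side 2) (side 3) (side 4)
    where
    outside : ∀ {x} j → InPart D i x → part x ≢ part (V j)
    outside j x∈i e = i≢X (trans (sym x∈i) (trans e (V∈X j)))
    side : ∀ j → u ∼ v ⊎ Side u v j
    side j with arc? u (V j) | arc? v (V j)
    ... | yes u⟶Vj | yes v⟶Vj = inj₁ (commonOut⇒∼ u≢v u⟶Vj v⟶Vj)
    ... | no u↛Vj  | _         = inj₂ (inj₁ (¬arc⇒arc (outside j u∈i) u↛Vj))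
    ... | yes _    | no v↛Vj   = inj₂ (inj₂ (¬arc⇒arc (outside j v∈i) v↛Vj))
    firstAdj : u ∼ v ⊎ Side u v 0 → u ∼ v ⊎ Side u v 1 → u ∼ v ⊎ Side u v 2 →
               u ∼ v ⊎ Side u v 3 → u ∼ v ⊎ Side u v 4 → u ∼ v
    firstAdj (inj₁ u∼v) _ _ _ _ = u∼v
    firstAdj _ (inj₁ u∼v) _ _ _ = u∼v
    firstAdj _ _ (inj₁ u∼v) _ _ = u∼v
    firstAdj _ _ _ (inj₁ u∼v) _ = u∼v
    firstAdj _ _ _ _ (inj₁ u∼v) = u∼v
    firstAdj (inj₂ (inj₁ V0⟶u)) (inj₂ s₁) (inj₂ s₂) (inj₂ s₃) (inj₂ s₄) =
      ⊥-elim (¬alternating V0⟶u s₁ s₂ s₃ s₄)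
    firstAdj (inj₂ (inj₂ V0⟶v)) (inj₂ s₁) (inj₂ s₂) (inj₂ s₃) (inj₂ s₄) =
      ⊥-elim (¬alternating V0⟶v (swap s₁) (swap s₂) (swap s₃) (swap s₄))

theorem4p5 : (D : MultipartiteTournament) → Loose D →
    (∃ λ (L : Hole D) → Hole.len L ≥ 5) →
    ∃ λ (X : Fin (MultipartiteTournament.k D)) →
      (¬ Competing D X × (∀ i → ¬ Competing D i → i ≡ X)) ×
      (∀ (L : Hole D) → Hole.len L ≥ 5 →
        ∃ λ (Y : Fin (MultipartiteTournament.k D)) →
          Y ≢ X × partSize D Y ≥ Hole.len L ×
          (∀ j → OutInto D Y (Hole.vtx L j)) ×
          (∀ v → OutInto D Y v → InPart D X v))
theorem4p5 D _ (L₀ , L₀≥5) = X , (¬competing-X , unique) , λ L L≥5 →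
    subst (HasOutPart D L) (unique _ (LongHole.¬competing-X D L L≥5)) (LongHole.hasOutPart D L L≥5)
  where
  open LongHole D L₀ L₀≥5 using (X; ¬competing-X; competing-others)
  unique : ∀ i → ¬ Competing D i → i ≡ X
  unique i ¬competing with i Fin.≟ X
  ... | yes i≡X = i≡X
  ... | no i≢X  = ⊥-elim (¬competing (competing-others i i≢X))
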